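{- Let $G$ be a graph with $\mathrm{tw}(G)\le 2$, let $x\in V(G)$, and let $P$ be a simple path in $G-x$ visiting vertices $v_1,v_2,v_3\in N_G(x)$ in this order. Then $\{v_2,x\}$ separates $v_1$ from $v_3$ in $G$, i.e. $G-\{v_2,x\}$ contains no path between $v_1$ and $v_3$.
   Context: Graphs are finite, simple, undirected; $\mathrm{tw}$ is treewidth; $N_G(x)$ is the open neighbourhood of $x$. -}

module Defs where

open import Data.Nat using (ℕ; _≤_)
open import Data.Fin using (Fin)
open import Data.Fin.Subset using (Subset; _∈_; ∣_∣)
open import Data.List using (List; []; _∷_; _++_; head; last; length)
open import Data.List.Relation.Unary.Linked using (Linked)
open import Data.List.Relation.Unary.Unique.Propositional using (Unique)
import Data.List.Relation.Unary.All
import Data.Nat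
open import Data.Maybe using (just)
open import Data.Product using (Σ; ∃; _×_)
open import Relation.Binary.PropositionalEquality using (_≡_)
open import Relation.Nullary using (¬_)

record Graph : Set₁ where
  field
    n       : ℕ
    Adj     : Fin n → Fin n → Set
    sym     : ∀ {u v} → Adj u v → Adj v u
    irrefl  : ∀ {u} → ¬ Adj u u

open Graph public

IsPath : (G : Graph) → List (Fin (n G)) → Set
IsPath G ps = Linked (Adj G) ps × Unique ps

IsPathBetween : (G : Graph) → Fin (n G) → Fin (n G) → List (Fin (n G)) → Set
IsPathBetween G u v ps = IsPath G ps × head ps ≡ just u × last ps ≡ just v

HasCycle : Graph → Set
HasCycle G = Σ (Fin (n G)) λ a → Σ (List (Fin (n G))) λ rest →
  IsPath G (a ∷ rest) × 2 ≤ length rest × Σ (Fin (n G)) λ b → last rest ≡ just b × Adj G b a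

Connected : Graph → Set
Connected G = ∀ (u v : Fin (n G)) → ∃ λ ps → IsPathBetween G u v ps

IsTree : Graph → Set
IsTree T = Connected T × ¬ HasCycle T

record TreeDecomposition (G : Graph) (k : ℕ) : Set₁ where
  field
    T          : Graph
    tree       : IsTree T
    bag        : Fin (n T) → Subset (n G)
    vertexCov  : ∀ (v : Fin (n G)) → ∃ λ t → v ∈ bag t
    edgeCov    : ∀ (u v : Fin (n G)) → Adj G u v → ∃ λ t → u ∈ bag t × v ∈ bag t
    subtreeCon : ∀ (v : Fin (n G)) (s t : Fin (n T)) → v ∈ bag s → v ∈ bag t →
                 ∃ λ ps → IsPathBetween T s t ps × Data.List.Relation.Unary.All.All (λ r → v ∈ bag r) ps
    width      : ∀ (t : Fin (n T)) → ∣ bag t ∣ ≤ Data.Nat.suc k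

TwAtMost : Graph → ℕ → Set₁
TwAtMost G k = TreeDecomposition G k

{-# OPTIONS --safe #-}
-- Suppose Q were a v₁–v₃ path avoiding v₂ and x, and write the segment of P from v₁ to v₃ as
-- L v₂ R. Let b be the first vertex of Q in R and a the last vertex of Q in L before b. Then
-- {x}, L, v₂ followed by R up to b, and the stretch of Q strictly between a and b followed by the
-- rest of R, are the branch sets of a K₄ minor. But a graph with a tree decomposition of width k
-- has no K_{k+2} minor: the nodes whose bags meet a connected vertex set form a subtree, pairwise
-- intersecting subtrees of a tree share a node (Helly), and that bag would hold k + 2 vertices.
module Submission where

open import Defs
open import Data.Fin using (Fin)
open import Data.List using (List; _∷_; _++_)
open import Data.List.Membership.Propositional using (_∈_)
open import Data.Product using (Σ; ∃; _×_)
open import Relation.Binary.PropositionalEquality using (_≡_)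
open import Relation.Nullary using (¬_)

open import Level using (Level; _⊔_; 0ℓ)
open import Data.Empty using (⊥-elim)
open import Data.Fin using (zero; suc; _≟_)
open import Data.Fin.Subset using (Subset; ∣_∣) renaming (_∈_ to _∈ₛ_)
open import Data.Fin.Subset.Properties using (x∈p⇒∣p-x∣<∣p∣; x∈p∧x≢y⇒x∈p-y)
open import Data.List using ([]; [_]; head; last; length; lookup; tabulate)
open import Data.List.Properties using (++-assoc; length-tabulate)
open import Data.List.Membership.Propositional using (_∉_; find; lose)
open import Data.List.Membership.Propositional.Properties using (∈-++⁺ˡ; ∈-++⁺ʳ; ∈-++⁻; ∈-∃++; ∈-lookup)
import Data.List.Membership.DecPropositional as DecMembership
open import Data.List.Relation.Binary.Disjoint.Propositional using (Disjoint)
open import Data.List.Relation.Binary.Disjoint.Propositional.Properties using () renaming (sym to Disjoint-sym)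
open import Data.List.Relation.Binary.Subset.Propositional using (_⊆_)
open import Data.List.Relation.Unary.All as All using (All; []; _∷_)
open import Data.List.Relation.Unary.All.Properties using (¬Any⇒All¬; All¬⇒¬Any)
import Data.List.Relation.Unary.All.Properties as All
open import Data.List.Relation.Unary.AllPairs using (AllPairs; []; _∷_)
open import Data.List.Relation.Unary.Any using (Any; here; there; any?)
open import Data.List.Relation.Unary.Linked as Linked using (Linked; []; [-]; _∷_)
open import Data.List.Relation.Unary.Unique.Propositional using (Unique)
open import Data.List.Relation.Unary.Unique.Propositional.Properties
  using (tabulate⁺; Unique[x∷xs]⇒x∉xs) renaming (++⁺ to Unique-++⁺)
open import Data.Maybe using (just)
open import Data.Maybe.Properties using (just-injective)
open import Data.Nat using (ℕ; zero; suc; _≤_; z≤n; s≤s)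
open import Data.Nat.Properties using (≤-trans; <-irrefl; module ≤-Reasoning)
open import Data.Product using (∃₂; _,_; proj₁; proj₂)
open import Data.Sum using (_⊎_; inj₁; inj₂; [_,_]′; swap)
open import Function using (_∘_)
open import Relation.Binary using (Rel; Symmetric; DecidableEquality)
open import Relation.Binary.PropositionalEquality using (_≢_; refl; trans; cong; subst) renaming (sym to ≡-sym)
open import Relation.Nullary using (yes; no)
open import Relation.Unary using (Pred; Decidable; Satisfiable; ∁; _∩_; _∪_)

module _ {a} {A : Set a} where

  private variable
    ℓ p : Level
    x y u : A
    xs ys zs : List A

  Unique-∷⁺ : x ∉ xs → Unique xs → Unique (x ∷ xs)
  Unique-∷⁺ x∉xs xs! = ¬Any⇒All¬ _ x∉xs ∷ xs!

  Unique-++⁻ : ∀ xs → Unique (xs ++ ys) → Unique xs × Unique ys × Disjoint xs ys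
  Unique-++⁻ [] ys! = [] , ys! , λ ()
  Unique-++⁻ (x ∷ xs) (x∉ ∷ xsys!) =
    let xs! , ys! , xs∩ys=∅ = Unique-++⁻ xs xsys! in
    All.++⁻ˡ xs x∉ ∷ xs! , ys! , λ where
      (here refl , v∈ys) → All¬⇒¬Any (All.++⁻ʳ xs x∉) v∈ys
      (there v∈xs , v∈ys) → xs∩ys=∅ (v∈xs , v∈ys)

  Unique-++-++⁻ : ∀ xs ys → Unique (xs ++ ys ++ zs) → Disjoint xs ys × Disjoint xs zs × Disjoint ys zs
  Unique-++-++⁻ xs ys u =
    let _ , ys++zs! , xs∩ys++zs=∅ = Unique-++⁻ xs u in
    (λ (v∈xs , v∈ys) → xs∩ys++zs=∅ (v∈xs , ∈-++⁺ˡ v∈ys)) ,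
    (λ (v∈xs , v∈zs) → xs∩ys++zs=∅ (v∈xs , ∈-++⁺ʳ ys v∈zs)) ,
    proj₂ (proj₂ (Unique-++⁻ ys ys++zs!))

  Disjoint-[_] : x ∉ xs → Disjoint [ x ] xs
  Disjoint-[ x∉xs ] (here refl , x∈xs) = x∉xs x∈xs

  Disjoint-++ʳ : Disjoint xs ys → Disjoint xs zs → Disjoint xs (ys ++ zs)
  Disjoint-++ʳ {ys = ys} xs∩ys=∅ xs∩zs=∅ (v∈xs , v∈ys++zs) with ∈-++⁻ ys v∈ys++zs
  ... | inj₁ v∈ys = xs∩ys=∅ (v∈xs , v∈ys)
  ... | inj₂ v∈zs = xs∩zs=∅ (v∈xs , v∈zs)

  All∉⇒Disjoint : All (_∉ ys) xs → Disjoint xs ys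
  All∉⇒Disjoint xs∉ys (v∈xs , v∈ys) = All.lookup xs∉ys v∈xs v∈ys

  head-∈ : head xs ≡ just x → x ∈ xs
  head-∈ {xs = _ ∷ _} refl = here refl

  last-∈ : last xs ≡ just x → x ∈ xs
  last-∈ {xs = _ ∷ []} refl = here refl
  last-∈ {xs = _ ∷ _ ∷ _} last≡x = there (last-∈ last≡x)

  ∈⇒last-just : x ∈ xs → ∃ λ u → last xs ≡ just u
  ∈⇒last-just {xs = y ∷ []} _ = y , refl
  ∈⇒last-just {xs = _ ∷ y ∷ xs} _ = ∈⇒last-just {xs = y ∷ xs} (here refl)

  last⇒∷ʳ : last xs ≡ just x → ∃ λ ys → xs ≡ ys ++ [ x ]
  last⇒∷ʳ {xs = _ ∷ []} refl = [] , refl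
  last⇒∷ʳ {xs = y ∷ z ∷ xs} last≡x =
    let ys , eq = last⇒∷ʳ {xs = z ∷ xs} last≡x in y ∷ ys , cong (y ∷_) eq

  head-++ : ∀ xs → head (xs ++ y ∷ ys) ≡ head (xs ++ y ∷ zs)
  head-++ [] = refl
  head-++ (_ ∷ _) = refl

  last-++ : ∀ xs → last (xs ++ y ∷ ys) ≡ last (y ∷ ys)
  last-++ [] = refl
  last-++ (_ ∷ []) = refl
  last-++ (_ ∷ x ∷ xs) = last-++ (x ∷ xs)

  head≢last⇒2≤length : head xs ≡ just x → last xs ≡ just y → x ≢ y → 2 ≤ length xs
  head≢last⇒2≤length {xs = _ ∷ []} refl refl x≢x = ⊥-elim (x≢x refl)
  head≢last⇒2≤length {xs = _ ∷ _ ∷ _} _ _ _ = s≤s (s≤s z≤n)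

  head-Any : ∀ {P : Pred A p} xs → head (xs ++ y ∷ ys) ≡ just x → P x → ¬ P y → Any P xs
  head-Any [] refl px ¬px = ⊥-elim (¬px px)
  head-Any (_ ∷ _) refl px _ = here px

  module _ {P : Pred A p} (P? : Decidable P) where

    first-split : Any P xs → ∃₂ λ ys y → ∃ λ zs → xs ≡ ys ++ y ∷ zs × All (∁ P) ys × P y
    first-split {xs = x ∷ xs} any with P? x | any
    ... | yes px | _ = [] , x , xs , refl , [] , px
    ... | no ¬px | here px = ⊥-elim (¬px px)
    ... | no ¬px | there any′ =
      let ys , y , zs , eq , ys∉P , py = first-split any′ in
      x ∷ ys , y , zs , cong (x ∷_) eq , ¬px ∷ ys∉P , py

    last-split : Any P xs → ∃₂ λ ys y → ∃ λ zs → xs ≡ ys ++ y ∷ zs × P y × All (∁ P) zs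
    last-split {xs = x ∷ xs} any with any? P? xs | any
    ... | yes any′ | _ =
      let ys , y , zs , eq , py , zs∉P = last-split any′ in
      x ∷ ys , y , zs , cong (x ∷_) eq , py , zs∉P
    ... | no none | here px = [] , x , xs , refl , px , ¬Any⇒All¬ xs none
    ... | no none | there any′ = ⊥-elim (none any′)

  module _ {R : Rel A ℓ} where

    Linked-++⁻ˡ : ∀ xs → Linked R (xs ++ ys) → Linked R xs
    Linked-++⁻ˡ [] _ = []
    Linked-++⁻ˡ (_ ∷ []) _ = [-]
    Linked-++⁻ˡ (_ ∷ x ∷ xs) (r ∷ l) = r ∷ Linked-++⁻ˡ (x ∷ xs) l

    Linked-++⁻ʳ : ∀ xs → Linked R (xs ++ ys) → Linked R ys
    Linked-++⁻ʳ [] l = l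
    Linked-++⁻ʳ (_ ∷ xs) l = Linked-++⁻ʳ xs (Linked.tail l)

    Linked-∷ʳ⁻ : ∀ xs → Linked R (xs ++ y ∷ ys) → Linked R (xs ++ [ y ])
    Linked-∷ʳ⁻ [] _ = [-]
    Linked-∷ʳ⁻ (_ ∷ []) (r ∷ _) = r ∷ [-]
    Linked-∷ʳ⁻ (_ ∷ x ∷ xs) (r ∷ l) = r ∷ Linked-∷ʳ⁻ (x ∷ xs) l

    Linked-glue : ∀ xs → Linked R (xs ++ [ y ]) → Linked R (y ∷ ys) → Linked R (xs ++ y ∷ ys)
    Linked-glue [] _ l = l
    Linked-glue (_ ∷ []) (r ∷ _) l = r ∷ l
    Linked-glue (_ ∷ x ∷ xs) (r ∷ l₁) l = r ∷ Linked-glue (x ∷ xs) l₁ l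

    Linked-last-edge : ∀ xs → Linked R (xs ++ y ∷ ys) → last xs ≡ just u → R u y
    Linked-last-edge (_ ∷ []) (r ∷ _) refl = r
    Linked-last-edge (_ ∷ x ∷ xs) (_ ∷ l) last≡u = Linked-last-edge (x ∷ xs) l last≡u

    Linked-head-edge : Linked R (x ∷ xs) → y ∈ xs → ∃ λ v → v ∈ xs × R x v
    Linked-head-edge (r ∷ _) _ = _ , here refl , r

  AllPairs-lookup : ∀ {R : Rel A ℓ} → Symmetric R → AllPairs R xs →
                    ∀ {i j} → i ≢ j → R (lookup xs i) (lookup xs j)
  AllPairs-lookup _ (_ ∷ _) {zero} {zero} i≢i = ⊥-elim (i≢i refl)
  AllPairs-lookup _ (rs ∷ _) {zero} {suc j} _ = All.lookup rs (∈-lookup j)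
  AllPairs-lookup sym′ (rs ∷ _) {suc i} {zero} _ = sym′ (All.lookup rs (∈-lookup i))
  AllPairs-lookup sym′ (_ ∷ pairs) {suc i} {suc j} i≢j = AllPairs-lookup sym′ pairs (i≢j ∘ cong suc)

length≤∣p∣ : ∀ {m} {p : Subset m} {xs : List (Fin m)} → Unique xs → All (_∈ₛ p) xs → length xs ≤ ∣ p ∣
length≤∣p∣ {xs = []} _ _ = z≤n
length≤∣p∣ {p = p} {x ∷ xs} (x≢xs ∷ xs!) (x∈p ∷ xs⊆p) =
  ≤-trans (s≤s (length≤∣p∣ xs! (All.zipWith (λ (x≢y , y∈p) → x∈p∧x≢y⇒x∈p-y y∈p (x≢y ∘ ≡-sym)) (x≢xs , xs⊆p))))
          (x∈p⇒∣p-x∣<∣p∣ x∈p)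

module _ {G : Graph} where

  private
    V : Set
    V = Fin (n G)

  private variable
    s t u v m : V
    p q r : List V

  open DecMembership (_≟_ {n G}) using (_∈?_)

  IsPath-++⁻ˡ : ∀ p → IsPath G (p ++ q) → IsPath G p
  IsPath-++⁻ˡ p (linked , p++q!) = Linked-++⁻ˡ p linked , proj₁ (Unique-++⁻ p p++q!)

  IsPath-++⁻ʳ : ∀ p → IsPath G (p ++ q) → IsPath G q
  IsPath-++⁻ʳ p (linked , p++q!) = Linked-++⁻ʳ p linked , proj₁ (proj₂ (Unique-++⁻ p p++q!))

  IsPath-∷ʳ⁻ : ∀ p {v q} → IsPath G (p ++ v ∷ q) → IsPath G (p ++ [ v ])
  IsPath-∷ʳ⁻ p {v} {q} path =
    IsPath-++⁻ˡ (p ++ [ v ]) (subst (IsPath G) (≡-sym (++-assoc p [ v ] q)) path)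

  record Junction (s t m : V) (p q : List V) : Set where
    field
      c               : V
      c∈p             : c ∈ p
      c∈q             : c ∈ q
      prefix          : List V
      prefix-path     : IsPathBetween G s c prefix
      detour          : List V
      detour-path     : IsPathBetween G m t detour
      c∈detour        : c ∈ detour
      p⊆prefix∪detour : ∀ {w} → w ∈ p → w ∈ prefix ⊎ w ∈ detour

  -- The junction c is the last vertex of p lying on q.
  junction : IsPathBetween G s t p → IsPathBetween G m s q → Junction s t m p q
  junction {p = p} {q = q} (p-path , head-p , last-p) ((q-linked , q!) , head-q , last-q)
    with last-split (_∈? q) {xs = p} (lose (head-∈ head-p) (last-∈ last-q))
  ... | p₁ , c , p₂ , refl , c∈q , p₂∉q with ∈-∃++ c∈q
  ... | q₁ , q₂ , refl = record
    { c = c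
    ; c∈p = ∈-++⁺ʳ p₁ (here refl)
    ; c∈q = c∈q
    ; prefix = p₁ ++ [ c ]
    ; prefix-path = IsPath-∷ʳ⁻ p₁ p-path , trans (head-++ p₁) head-p , last-++ p₁
    ; detour = q₁ ++ c ∷ p₂
    ; detour-path = (detour-linked , detour!) , trans (head-++ q₁) head-q
                  , trans (last-++ q₁) (trans (≡-sym (last-++ p₁)) last-p)
    ; c∈detour = ∈-++⁺ʳ q₁ (here refl)
    ; p⊆prefix∪detour = split
    }
    where
    detour-linked : Linked (Adj G) (q₁ ++ c ∷ p₂)
    detour-linked = Linked-glue q₁ (Linked-∷ʳ⁻ q₁ q-linked) (Linked-++⁻ʳ p₁ (proj₁ p-path))
    q₁! = Unique-++⁻ q₁ q!
    detour! : Unique (q₁ ++ c ∷ p₂)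
    detour! = Unique-++⁺ (proj₁ q₁!) (proj₂ (IsPath-++⁻ʳ p₁ p-path)) λ where
        (w∈q₁ , here refl) → proj₂ (proj₂ q₁!) (w∈q₁ , here refl)
        (w∈q₁ , there w∈p₂) → All.lookup p₂∉q w∈p₂ (∈-++⁺ˡ w∈q₁)
    split : ∀ {w} → w ∈ p₁ ++ c ∷ p₂ → w ∈ p₁ ++ [ c ] ⊎ w ∈ q₁ ++ c ∷ p₂
    split w∈p with ∈-++⁻ p₁ w∈p
    ... | inj₁ w∈p₁ = inj₁ (∈-++⁺ˡ w∈p₁)
    ... | inj₂ (here refl) = inj₁ (∈-++⁺ʳ p₁ (here refl))
    ... | inj₂ (there w∈p₂) = inj₂ (∈-++⁺ʳ q₁ (there w∈p₂))

  -- The cycle runs along q from s up to the first vertex w of q on r, then along r to u.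
  closes-cycle : IsPath G (s ∷ q) → head q ≡ just v → last q ≡ just t →
                 IsPathBetween G t u r → s ∉ r → Adj G u s → u ≢ v → HasCycle G
  closes-cycle {s} {q} {u = u} {r = r} sq-path head-q last-q ((r-linked , r!) , head-r , last-r) s∉r u-s u≢v
    with first-split (_∈? r) {xs = q} (lose (last-∈ last-q) (head-∈ head-r))
  ... | α , w , β , refl , α∉r , w∈r with ∈-∃++ w∈r
  ... | γ , δ , refl =
    s , α ++ w ∷ δ , (cycle-linked , Unique-∷⁺ s∉cycle cycle!) ,
    head≢last⇒2≤length (trans (head-++ α) head-q) last-cycle (u≢v ∘ ≡-sym) ,
    u , last-cycle , u-s
    where
    last-cycle : last (α ++ w ∷ δ) ≡ just u
    last-cycle = trans (last-++ α) (trans (≡-sym (last-++ γ)) last-r)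
    cycle-linked : Linked (Adj G) (s ∷ α ++ w ∷ δ)
    cycle-linked = Linked-glue (s ∷ α) (Linked-∷ʳ⁻ (s ∷ α) (proj₁ sq-path)) (Linked-++⁻ʳ γ r-linked)
    α! = proj₁ (Unique-++⁻ α (proj₂ (IsPath-++⁻ʳ [ s ] sq-path)))
    s∉cycle : s ∉ α ++ w ∷ δ
    s∉cycle s∈ with ∈-++⁻ α s∈
    ... | inj₁ s∈α = Unique[x∷xs]⇒x∉xs (proj₂ sq-path) (∈-++⁺ˡ s∈α)
    ... | inj₂ s∈wδ = s∉r (∈-++⁺ʳ γ s∈wδ)
    cycle! : Unique (α ++ w ∷ δ)
    cycle! = Unique-++⁺ α! (proj₁ (proj₂ (Unique-++⁻ γ r!)))
      λ (z∈α , z∈wδ) → All.lookup α∉r z∈α (∈-++⁺ʳ γ z∈wδ)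

  acyclic⇒path⊆ : ¬ HasCycle G → IsPathBetween G s t p → IsPathBetween G t s r → p ⊆ r
  acyclic⇒path⊆ {p = []} _ (_ , () , _)
  acyclic⇒path⊆ {p = _ ∷ []} _ (_ , refl , refl) (_ , _ , last-r) (here refl) = last-∈ last-r
  acyclic⇒path⊆ {p = s ∷ v ∷ p} {r = r} acyclic (p-path , refl , last-p) (r-path , head-r , last-r) w∈p
    with last⇒∷ʳ {xs = r} last-r
  ... | [] , refl = ⊥-elim (Unique[x∷xs]⇒x∉xs (proj₂ p-path)
                              (subst (_∈ v ∷ p) (≡-sym (just-injective head-r)) (last-∈ last-p)))
  ... | x ∷ r₀ , refl with ∈⇒last-just {xs = x ∷ r₀} (here refl)
  ... | u , last-r₀ with u ≟ v | w∈p
  ... | yes refl | here refl = last-∈ last-r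
  ... | yes refl | there w∈vp =
    ∈-++⁺ˡ (acyclic⇒path⊆ acyclic (IsPath-++⁻ʳ [ s ] p-path , refl , last-p)
                                   (IsPath-++⁻ˡ (x ∷ r₀) r-path , head-r , last-r₀) w∈vp)
  ... | no u≢v | _ = ⊥-elim (acyclic (closes-cycle p-path refl last-p
                          (IsPath-++⁻ˡ (x ∷ r₀) r-path , head-r , last-r₀)
                          (λ s∈r₀ → proj₂ (proj₂ (Unique-++⁻ (x ∷ r₀) (proj₂ r-path))) (s∈r₀ , here refl))
                          (Linked-last-edge (x ∷ r₀) (proj₁ r-path) last-r₀) u≢v))

Convex : (T : Graph) → Pred (Fin (n T)) 0ℓ → Set
Convex T S = ∀ {s t p} → S s → S t → IsPathBetween T s t p → All S p

module _ {T : Graph} where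

  private variable
    A B C : Pred (Fin (n T)) 0ℓ

  Convex-resp : (∀ {t} → A t → B t) → (∀ {t} → B t → A t) → Convex T A → Convex T B
  Convex-resp A⇒B B⇒A convex bs bt path = All.map A⇒B (convex (B⇒A bs) (B⇒A bt) path)

  ∩-convex : Convex T A → Convex T B → Convex T (A ∩ B)
  ∩-convex A-convex B-convex (as , bs) (at , bt) path = All.zip (A-convex as at path , B-convex bs bt path)

  module _ (connected : Connected T) where

    -- Join a path from a common point m to s at the junction with p.
    ∪-convex-crossing : Convex T A → Convex T B → Satisfiable (A ∩ B) →
                        ∀ {s t p} → A s → B t → IsPathBetween T s t p → All (A ∪ B) p
    ∪-convex-crossing A-convex B-convex (m , am , bm) {s} as bt path with connected m s
    ... | q , q-path = All.tabulate (λ w∈p → [ inj₁ ∘ All.lookup prefix⊆A , inj₂ ∘ All.lookup detour⊆B ]′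
                                               (p⊆prefix∪detour w∈p))
      where
      open Junction (junction {G = T} path q-path)
      prefix⊆A = A-convex as (All.lookup (A-convex am as q-path) c∈q) prefix-path
      detour⊆B = B-convex bm bt detour-path

    ∪-convex : Convex T A → Convex T B → Satisfiable (A ∩ B) → Convex T (A ∪ B)
    ∪-convex A-convex B-convex _ (inj₁ as) (inj₁ at) path = All.map inj₁ (A-convex as at path)
    ∪-convex A-convex B-convex _ (inj₂ bs) (inj₂ bt) path = All.map inj₂ (B-convex bs bt path)
    ∪-convex A-convex B-convex meet (inj₁ as) (inj₂ bt) path =
      ∪-convex-crossing A-convex B-convex meet as bt path
    ∪-convex A-convex B-convex (m , am , bm) (inj₂ bs) (inj₁ at) path =
      All.map swap (∪-convex-crossing B-convex A-convex (m , bm , am) bs at path)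

    helly₃ : Convex T A → Convex T B → Convex T C →
             Satisfiable (A ∩ B) → Satisfiable (B ∩ C) → Satisfiable (A ∩ C) → Satisfiable (A ∩ B ∩ C)
    helly₃ A-convex B-convex C-convex (x , ax , bx) (y , by , cy) (z , az , cz)
      with connected x y | connected z x
    ... | p , p-path | q , q-path =
      c , All.lookup (A-convex az ax q-path) c∈q , All.lookup (B-convex bx by p-path) c∈p ,
          All.lookup (C-convex cz cy detour-path) c∈detour
      where open Junction (junction {G = T} p-path q-path)

    -- Replace the first two sets by their intersection; helly₃ keeps the family pairwise meeting.
    helly : ∀ k (S : Fin (suc k) → Pred (Fin (n T)) 0ℓ) → (∀ i → Convex T (S i)) →
            (∀ i j → Satisfiable (S i ∩ S j)) → Satisfiable (λ t → ∀ i → S i t)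
    helly zero S _ meet = let t , s₀ , _ = meet zero zero in t , λ { zero → s₀ }
    helly (suc k) S convex meet with helly k S′ convex′ meet′
      where
      S′ : Fin (suc k) → Pred (Fin (n T)) 0ℓ
      S′ zero = S zero ∩ S (suc zero)
      S′ (suc i) = S (suc (suc i))
      convex′ : ∀ i → Convex T (S′ i)
      convex′ zero = ∩-convex (convex zero) (convex (suc zero))
      convex′ (suc i) = convex (suc (suc i))
      triple : ∀ i → Satisfiable (S′ zero ∩ S′ (suc i))
      triple i = let t , s₀ , s₁ , sᵢ = helly₃ (convex zero) (convex (suc zero)) (convex (suc (suc i)))
                                                (meet zero (suc zero)) (meet (suc zero) (suc (suc i)))
                                                (meet zero (suc (suc i)))
                 in t , (s₀ , s₁) , sᵢ
      meet′ : ∀ i j → Satisfiable (S′ i ∩ S′ j)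
      meet′ zero zero = let t , s₀₁ = meet zero (suc zero) in t , s₀₁ , s₀₁
      meet′ zero (suc j) = triple j
      meet′ (suc i) zero = let t , s₀₁ , sᵢ = triple i in t , sᵢ , s₀₁
      meet′ (suc i) (suc j) = meet (suc (suc i)) (suc (suc j))
    ... | t , in-S′ = t , λ where
      zero → proj₁ (in-S′ zero)
      (suc zero) → proj₂ (in-S′ zero)
      (suc (suc i)) → in-S′ (suc i)

Touching : (G : Graph) → Rel (List (Fin (n G))) 0ℓ
Touching G W W′ = ∃₂ λ u v → u ∈ W × v ∈ W′ × Adj G u v

-- Each branch set is given as a walk, which makes it connected.
record CliqueMinor (G : Graph) (m : ℕ) : Set where
  field
    branch    : Fin m → List (Fin (n G))
    connected : ∀ i → Linked (Adj G) (branch i)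
    nonempty  : ∀ i → ∃ (_∈ branch i)
    disjoint  : ∀ {i j} → i ≢ j → Disjoint (branch i) (branch j)
    touching  : ∀ {i j} → i ≢ j → Touching G (branch i) (branch j)

module _ {G : Graph} where

  Touching-sym : Symmetric (Touching G)
  Touching-sym (u , v , u∈W , v∈W′ , e) = v , u , v∈W′ , u∈W , Graph.sym G e

  cliqueMinor : (Ws : List (List (Fin (n G)))) → All (Linked (Adj G)) Ws → All (λ W → ∃ (_∈ W)) Ws →
                AllPairs Disjoint Ws → AllPairs (Touching G) Ws → CliqueMinor G (length Ws)
  cliqueMinor Ws linked nonempty disjoint touching = record
    { branch = lookup Ws
    ; connected = All.lookup linked ∘ ∈-lookup
    ; nonempty = All.lookup nonempty ∘ ∈-lookup
    ; disjoint = AllPairs-lookup Disjoint-sym disjoint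
    ; touching = AllPairs-lookup Touching-sym touching
    }

module _ {G : Graph} {k : ℕ} (D : TreeDecomposition G k) where
  open TreeDecomposition D

  Meets : List (Fin (n G)) → Pred (Fin (n T)) 0ℓ
  Meets W t = Any (_∈ₛ bag t) W

  bags∋-convex : ∀ v → Convex T (λ t → v ∈ₛ bag t)
  bags∋-convex v {s} {t} v∈s v∈t path with subtreeCon v t s v∈t v∈s
  ... | r , r-path , r⊆bags =
    All.tabulate (All.lookup r⊆bags ∘ acyclic⇒path⊆ {G = T} (proj₂ tree) path r-path)

  Meets-convex : ∀ W → Linked (Adj G) W → Convex T (Meets W)
  Meets-convex [] _ ()
  Meets-convex (w ∷ []) _ = Convex-resp {T = T} here (λ { (here w∈t) → w∈t ; (there ()) }) (bags∋-convex w)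
  Meets-convex (w ∷ w′ ∷ W) (e ∷ linked) with edgeCov w w′ e
  ... | t , w∈t , w′∈t =
    Convex-resp {T = T} [ here , there ]′ (λ { (here w∈t) → inj₁ w∈t ; (there meets) → inj₂ meets })
      (∪-convex {T = T} (proj₁ tree) (bags∋-convex w) (Meets-convex (w′ ∷ W) linked) (t , w∈t , here w′∈t))

  module _ {m} (K : CliqueMinor G m) where
    open CliqueMinor K

    branches-share-bags : ∀ i j → Satisfiable (Meets (branch i) ∩ Meets (branch j))
    branches-share-bags i j with i ≟ j
    ... | yes refl = let w , w∈ = nonempty i ; t , w∈t = vertexCov w in t , lose w∈ w∈t , lose w∈ w∈t
    ... | no i≢j = let u , v , u∈ , v∈ , e = touching i≢j ; t , u∈t , v∈t = edgeCov u v e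
                   in t , lose u∈ u∈t , lose v∈ v∈t

    bag-meeting-all-branches⇒m≤∣bag∣ : ∀ {t} → (∀ i → Meets (branch i) t) → m ≤ ∣ bag t ∣
    bag-meeting-all-branches⇒m≤∣bag∣ {t} meets = begin
      m                     ≡⟨ ≡-sym (length-tabulate rep) ⟩
      length (tabulate rep) ≤⟨ length≤∣p∣ (tabulate⁺ rep-injective) (All.tabulate⁺ rep∈t) ⟩
      ∣ bag t ∣             ∎
      where
      open ≤-Reasoning
      rep : Fin m → Fin (n G)
      rep i = proj₁ (find (meets i))
      rep∈branch : ∀ i → rep i ∈ branch i
      rep∈branch i = proj₁ (proj₂ (find (meets i)))
      rep∈t : ∀ i → rep i ∈ₛ bag t
      rep∈t i = proj₂ (proj₂ (find (meets i)))
      rep-injective : ∀ {i j} → rep i ≡ rep j → i ≡ j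
      rep-injective {i} {j} eq with i ≟ j
      ... | yes i≡j = i≡j
      ... | no i≢j = ⊥-elim (disjoint i≢j (rep∈branch i , subst (_∈ branch j) (≡-sym eq) (rep∈branch j)))

  cliqueMinor≤1+width : ∀ {m} → CliqueMinor G m → m ≤ suc k
  cliqueMinor≤1+width {zero} _ = z≤n
  cliqueMinor≤1+width {suc m} K =
    let t , meets = helly {T = T} (proj₁ tree) m (Meets ∘ branch) (λ i → Meets-convex (branch i) (connected i))
                          (branches-share-bags K)
    in ≤-trans (bag-meeting-all-branches⇒m≤∣bag∣ K meets) (width t)
    where open CliqueMinor K

module _ {a ℓ} {A : Set a} (_≟A_ : DecidableEquality A) (E : Rel A ℓ) where

  open DecMembership _≟A_ using (_∈?_)

  record Bridge (L R Q : List A) : Set (a ⊔ ℓ) where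
    constructor bridge-via
    field
      start end      : A
      interior       : List A
      start∈L        : start ∈ L
      end∈R          : end ∈ R
      linked         : Linked E (start ∷ interior ++ [ end ])
      interior∩L=∅   : Disjoint interior L
      interior∩R=∅   : Disjoint interior R
      interior⊆Q     : interior ⊆ Q

  -- end is the first vertex of Q in R, start the last vertex in L before it.
  find-bridge : ∀ {L R Q s t} → Linked E Q → head Q ≡ just s → s ∈ L → last Q ≡ just t → t ∈ R →
                Disjoint L R → Bridge L R Q
  find-bridge {L} {R} {Q} linked head-Q s∈L last-Q t∈R L∩R=∅
    with first-split (_∈? R) {xs = Q} (lose (last-∈ last-Q) t∈R)
  ... | Q₁ , b , Q₂ , refl , Q₁∉R , b∈R
    with last-split (_∈? L) (head-Any Q₁ head-Q s∈L (λ b∈L → L∩R=∅ (b∈L , b∈R)))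
  ... | Q₁₁ , a , Q₁₂ , refl , a∈L , Q₁₂∉L =
    bridge-via a b Q₁₂ a∈L b∈R
      (Linked-++⁻ʳ Q₁₁ (subst (Linked E) (++-assoc Q₁₁ (a ∷ Q₁₂) [ b ])
                                (Linked-∷ʳ⁻ (Q₁₁ ++ a ∷ Q₁₂) linked)))
      (All∉⇒Disjoint Q₁₂∉L)
      (λ (v∈Q₁₂ , v∈R) → All.lookup Q₁∉R (∈-++⁺ʳ Q₁₁ (there v∈Q₁₂)) v∈R)
      (∈-++⁺ˡ ∘ ∈-++⁺ʳ Q₁₁ ∘ there)

module _ {G : Graph} where

  K₄-minor-from-bridge : ∀ L R′ Rb {x v₁ v₂ v₃ a b mid} →
    IsPath G (L ++ v₂ ∷ R′ ++ b ∷ Rb) → x ∉ L ++ v₂ ∷ R′ ++ b ∷ Rb → v₁ ∈ L → last (b ∷ Rb) ≡ just v₃ →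
    Adj G x v₁ → Adj G x v₂ → Adj G x v₃ →
    a ∈ L → Linked (Adj G) (a ∷ mid ++ [ b ]) → Disjoint mid L → Disjoint (v₂ ∷ R′) mid → x ∉ mid →
    CliqueMinor G 4
  K₄-minor-from-bridge L R′ Rb {x} {v₁} {v₂} {v₃} {a} {b} {mid} (M-linked , M!) x∉M v₁∈L last-Rb
                       x-v₁ x-v₂ x-v₃ a∈L a-mid-b mid∩L=∅ V∩mid=∅ x∉mid =
    cliqueMinor ([ x ] ∷ L ∷ (v₂ ∷ R′) ∷ (mid ++ b ∷ Rb) ∷ [])
      ([-] ∷ Linked-++⁻ˡ L M-linked ∷ Linked-++⁻ˡ (v₂ ∷ R′) V-Rb-linked ∷ Linked.tail a-B-linked ∷ [])
      ((x , here refl) ∷ (v₁ , v₁∈L) ∷ (v₂ , here refl) ∷ (b , b∈B) ∷ [])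
      ((Disjoint-[ x∉M ∘ ∈-++⁺ˡ ] ∷ Disjoint-[ x∉M ∘ ∈-++⁺ʳ L ∘ ∈-++⁺ˡ ] ∷ Disjoint-[ x∉B ] ∷ [])
      ∷ (L∩V=∅ ∷ Disjoint-++ʳ (Disjoint-sym mid∩L=∅) L∩Rb=∅ ∷ [])
      ∷ (Disjoint-++ʳ V∩mid=∅ V∩Rb=∅ ∷ [])
      ∷ [] ∷ [])
      (((x , v₁ , here refl , v₁∈L , x-v₁) ∷ (x , v₂ , here refl , here refl , x-v₂)
         ∷ (x , v₃ , here refl , ∈-++⁺ʳ mid (last-∈ last-Rb) , x-v₃) ∷ [])
      ∷ (L-V-edge ∷ L-B-edge ∷ [])
      ∷ (V-B-edge ∷ [])
      ∷ [] ∷ [])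
    where
    V-Rb-linked : Linked (Adj G) (v₂ ∷ R′ ++ b ∷ Rb)
    V-Rb-linked = Linked-++⁻ʳ L M-linked
    a-B-linked : Linked (Adj G) (a ∷ mid ++ b ∷ Rb)
    a-B-linked = Linked-glue (a ∷ mid) a-mid-b (Linked-++⁻ʳ (v₂ ∷ R′) V-Rb-linked)
    b∈B : b ∈ mid ++ b ∷ Rb
    b∈B = ∈-++⁺ʳ mid (here refl)
    x∉B : x ∉ mid ++ b ∷ Rb
    x∉B x∈B with ∈-++⁻ mid x∈B
    ... | inj₁ x∈mid = x∉mid x∈mid
    ... | inj₂ x∈Rb = x∉M (∈-++⁺ʳ L (∈-++⁺ʳ (v₂ ∷ R′) x∈Rb))
    M-disjoint = Unique-++-++⁻ L (v₂ ∷ R′) M!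
    L∩V=∅ = proj₁ M-disjoint
    L∩Rb=∅ = proj₁ (proj₂ M-disjoint)
    V∩Rb=∅ = proj₂ (proj₂ M-disjoint)
    L-V-edge : Touching G L (v₂ ∷ R′)
    L-V-edge = let u , last-L = ∈⇒last-just v₁∈L in
      u , v₂ , last-∈ last-L , here refl , Linked-last-edge L M-linked last-L
    L-B-edge : Touching G L (mid ++ b ∷ Rb)
    L-B-edge = let v , v∈B , e = Linked-head-edge a-B-linked b∈B in a , v , a∈L , v∈B , e
    V-B-edge : Touching G (v₂ ∷ R′) (mid ++ b ∷ Rb)
    V-B-edge = let u , last-V = ∈⇒last-just {xs = v₂ ∷ R′} (here refl) in
      u , b , last-∈ last-V , b∈B , Linked-last-edge (v₂ ∷ R′) V-Rb-linked last-V

  K₄-minor : ∀ L R {x v₁ v₂ v₃} → IsPath G (L ++ v₂ ∷ R) → x ∉ L ++ v₂ ∷ R → v₁ ∈ L → last R ≡ just v₃ →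
             Adj G x v₁ → Adj G x v₂ → Adj G x v₃ →
             ∀ {Q} → IsPathBetween G v₁ v₃ Q → v₂ ∉ Q → x ∉ Q → CliqueMinor G 4
  K₄-minor L R M-path x∉M v₁∈L last-R x-v₁ x-v₂ x-v₃ ((Q-linked , _) , head-Q , last-Q) v₂∉Q x∉Q
    with find-bridge _≟_ (Adj G) Q-linked head-Q v₁∈L last-Q (last-∈ last-R)
           (λ (v∈L , v∈R) → proj₂ (proj₂ (Unique-++⁻ L (proj₂ M-path))) (v∈L , there v∈R))
  ... | bridge-via a b mid a∈L b∈R a-mid-b mid∩L=∅ mid∩R=∅ mid⊆Q with ∈-∃++ b∈R
  ... | R′ , Rb , refl =
    K₄-minor-from-bridge L R′ Rb M-path x∉M v₁∈L (trans (≡-sym (last-++ R′)) last-R) x-v₁ x-v₂ x-v₃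
      a∈L a-mid-b mid∩L=∅
      (λ where
        (here refl , v₂∈mid) → v₂∉Q (mid⊆Q v₂∈mid)
        (there v∈R′ , v∈mid) → mid∩R=∅ (v∈mid , ∈-++⁺ˡ v∈R′))
      (x∉Q ∘ mid⊆Q)

lemma6p8 : (G : Graph) → TwAtMost G 2 → (x : Fin (n G)) →
    (P : List (Fin (n G))) → IsPath G P → ¬ (x ∈ P) →
    (v₁ v₂ v₃ : Fin (n G)) → Adj G x v₁ → Adj G x v₂ → Adj G x v₃ →
    (∃ λ as → ∃ λ bs → ∃ λ cs → ∃ λ ds → P ≡ as ++ v₁ ∷ bs ++ v₂ ∷ cs ++ v₃ ∷ ds) →
    ¬ (∃ λ Q → IsPathBetween G v₁ v₃ Q × ¬ (v₂ ∈ Q) × ¬ (x ∈ Q))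
lemma6p8 G D x _ P-path x∉P v₁ v₂ v₃ x-v₁ x-v₂ x-v₃ (as , bs , cs , ds , refl) (Q , Q-path , v₂∉Q , x∉Q) =
  <-irrefl refl (cliqueMinor≤1+width D K₄)    -- 4 ≤ 3 unfolds to 3 < 3
  where
  M = v₁ ∷ bs ++ v₂ ∷ cs ++ [ v₃ ]
  M++ds : M ++ ds ≡ v₁ ∷ bs ++ v₂ ∷ cs ++ v₃ ∷ ds
  M++ds = cong (v₁ ∷_) (trans (++-assoc bs (v₂ ∷ cs ++ [ v₃ ]) ds)
                              (cong (λ zs → bs ++ v₂ ∷ zs) (++-assoc cs [ v₃ ] ds)))
  M-path : IsPath G M
  M-path = IsPath-++⁻ˡ {G = G} M
             (IsPath-++⁻ʳ {G = G} as (subst (λ zs → IsPath G (as ++ zs)) (≡-sym M++ds) P-path))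
  x∉M : x ∉ M
  x∉M = x∉P ∘ ∈-++⁺ʳ as ∘ subst (x ∈_) M++ds ∘ ∈-++⁺ˡ
  K₄ : CliqueMinor G 4
  K₄ = K₄-minor (v₁ ∷ bs) (cs ++ [ v₃ ]) M-path x∉M (here refl) (last-++ cs) x-v₁ x-v₂ x-v₃ Q-path v₂∉Q x∉Q
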